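{- Let $n\ge 1$ and let $(s_0,s_1,s_2)$ and $(t_0,t_1,t_2)$ be two ordered triples of non-negative integers each summing to $n$. Then $$\binom{n}{s_0,s_1,s_2}\cdot A_{(s_0,s_1,s_2)^\perp}[t_0,t_1,t_2]=\binom{n}{t_0,t_1,t_2}\cdot A_{(t_0,t_1,t_2)^\perp}[s_0,s_1,s_2].$$
   Context: $\mathbb{Z}_3$ denotes the integers modulo $3$. For $\mathbf v=(v_1,\dots,v_n)\in\mathbb{Z}_3^n$ and $i\in\mathbb{Z}_3$ let $\mathrm{wt}_i(\mathbf v)=|\{j: v_j=i\}|$; the type of $\mathbf v$ is $T(\mathbf v)=(\mathrm{wt}_0(\mathbf v),\mathrm{wt}_1(\mathbf v),\mathrm{wt}_2(\mathbf v))$. For a linear code $C\subseteq\mathbb{Z}_3^n$ its dual is $C^\perp=\{\mathbf v\in\mathbb{Z}_3^n:\mathbf v\cdot\mathbf c=0\ \forall \mathbf c\in C\}$ (with $\mathbf v\cdot\mathbf c=\sum_i v_ic_i$), and $A_C[r,s,t]$ denotes the number of codewords of $C$ of type $(r,s,t)$. For a nonzero $\mathbf v$, let $C_{\mathbf v}=\{\mathbf 0,\mathbf v,-\mathbf v\}$, and for $\mathbf v=\mathbf 0$ let $C_{\mathbf v}=\{\mathbf 0\}$. Since $A_{C_{\mathbf v}^\perp}$ depends only on $T(\mathbf v)$, write $A_{(t_0,t_1,t_2)^\perp}[r,s,t]$ for $A_{C_{\mathbf v}^\perp}[r,s,t]$ where $\mathbf v$ is any vector of type $(t_0,t_1,t_2)$.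 -}

module Defs where

open import Data.Nat using (ℕ; zero; suc; _+_; _*_)
open import Data.Nat.Combinatorics using (_C_)
open import Data.Fin using (Fin; zero; suc)
open import Data.Fin.Properties using (_≟_)
open import Data.Vec using (Vec; []; _∷_; map; foldr; zipWith; allFin)
open import Data.List using (List; []; _∷_; length; filter; concatMap; _++_)
import Data.List as L
open import Data.Product using (_×_; _,_)
open import Data.List.Relation.Unary.All using (All)
open import Data.List.Relation.Unary.All.Properties using ()
open import Relation.Binary.PropositionalEquality using (_≡_)
open import Relation.Nullary using (Dec; yes; no)
open import Relation.Nullary.Decidable using (_×-dec_)

Z3 : Set
Z3 = Fin 3

_+₃_ : Z3 → Z3 → Z3
zero +₃ y = y
suc zero +₃ zero = suc zero
suc zero +₃ suc zero = suc (suc zero)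
suc zero +₃ suc (suc zero) = zero
suc (suc zero) +₃ zero = suc (suc zero)
suc (suc zero) +₃ suc zero = zero
suc (suc zero) +₃ suc (suc zero) = suc zero

_*₃_ : Z3 → Z3 → Z3
zero *₃ y = zero
suc zero *₃ y = y
suc (suc zero) *₃ zero = zero
suc (suc zero) *₃ suc zero = suc (suc zero)
suc (suc zero) *₃ suc (suc zero) = suc zero

neg₃ : Z3 → Z3
neg₃ zero = zero
neg₃ (suc zero) = suc (suc zero)
neg₃ (suc (suc zero)) = suc zero

_·_ : ∀ {n} → Vec Z3 n → Vec Z3 n → Z3
v · c = foldr _ _+₃_ zero (zipWith _*₃_ v c)

wt : ∀ {n} → Z3 → Vec Z3 n → ℕ
wt i [] = 0
wt i (x ∷ v) with x ≟ i
... | yes _ = suc (wt i v)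
... | no _ = wt i v

T : ∀ {n} → Vec Z3 n → ℕ × ℕ × ℕ
T v = wt zero v , wt (suc zero) v , wt (suc (suc zero)) v

allVecs : (n : ℕ) → List (Vec Z3 n)
allVecs zero = [] ∷ []
allVecs (suc n) = concatMap (λ x → L.map (x ∷_) (allVecs n)) (0F ∷ 1F ∷ 2F ∷ [])
  where
  0F 1F 2F : Z3
  0F = zero
  1F = suc zero
  2F = suc (suc zero)

zeroVec : ∀ n → Vec Z3 n
zeroVec zero = []
zeroVec (suc n) = zero ∷ zeroVec n

isZeroVec : ∀ {n} → Vec Z3 n → Set
isZeroVec {n} v = v ≡ zeroVec n

isZeroVec? : ∀ {n} (v : Vec Z3 n) → Dec (isZeroVec v)
isZeroVec? [] = yes _≡_.refl
isZeroVec? (x ∷ v) with x ≟ zero | isZeroVec? v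
... | yes _≡_.refl | yes _≡_.refl = yes _≡_.refl
... | no x≢0 | _ = no λ { _≡_.refl → x≢0 _≡_.refl }
... | yes _ | no v≢0 = no λ { _≡_.refl → v≢0 _≡_.refl }

Cv : ∀ {n} → Vec Z3 n → List (Vec Z3 n)
Cv {n} v with isZeroVec? v
... | yes _ = zeroVec n ∷ []
... | no _ = zeroVec n ∷ v ∷ map neg₃ v ∷ []

inDual : ∀ {n} → List (Vec Z3 n) → Vec Z3 n → Set
inDual Cs w = All (λ c → w · c ≡ zero) Cs

inDual? : ∀ {n} (Cs : List (Vec Z3 n)) (w : Vec Z3 n) → Dec (inDual Cs w)
inDual? [] w = yes All.[]
inDual? (c ∷ Cs) w with (w · c) ≟ zero | inDual? Cs w
... | yes p | yes ps = yes (p All.∷ ps)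
... | no ¬p | _ = no λ { (p All.∷ _) → ¬p p }
... | yes _ | no ¬ps = no λ { (_ All.∷ ps) → ¬ps ps }

_≟T_ : (a b : ℕ × ℕ × ℕ) → Dec (a ≡ b)
(a₀ , a₁ , a₂) ≟T (b₀ , b₁ , b₂) with a₀ Data.Nat.≟ b₀ | a₁ Data.Nat.≟ b₁ | a₂ Data.Nat.≟ b₂
... | yes _≡_.refl | yes _≡_.refl | yes _≡_.refl = yes _≡_.refl
... | no p | _ | _ = no λ { _≡_.refl → p _≡_.refl }
... | yes _ | no p | _ = no λ { _≡_.refl → p _≡_.refl }
... | yes _ | yes _ | no p = no λ { _≡_.refl → p _≡_.refl }

A-dual : ∀ {n} → Vec Z3 n → ℕ × ℕ × ℕ → ℕ
A-dual {n} v rst =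
  length (filter (λ w → inDual? (Cv v) w ×-dec (T w ≟T rst)) (allVecs n))

-- multinomial coefficient (s₀+s₁+s₂ choose s₀,s₁,s₂) = C(n,s₀)·C(n-s₀,s₁)
multinomial : ℕ × ℕ × ℕ → ℕ
multinomial (s₀ , s₁ , s₂) = ((s₀ + s₁ + s₂) C s₀) * ((s₁ + s₂) C s₁)

tsum : ℕ × ℕ × ℕ → ℕ
tsum (a , b , c) = a + b + c

{-# OPTIONS --safe #-}
-- Both sides count the pairs (u , w) with T u = s, T w = t and w · u = 0: membership in
-- C_u^⊥ is just w · u = 0 and the dot product is symmetric, so summing A_{C_u^⊥}[t] over the
-- u of type s gives (number of vectors of type s) · A_{(s)^⊥}[t], once we know that
-- A_{C_u^⊥}[t] depends only on T u. For that, view Σ_w φ (w · u , T w) as a functional of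
-- the weight φ: prepending a letter x to u precomposes it with an operator shift x, and these
-- operators commute, so the result depends only on how often each letter occurs in u.
-- Splitting off the first coordinate gives the Pascal recursion showing that the number of
-- vectors of type s is the multinomial coefficient.
module Submission where

open import Defs
open import Data.Nat using (ℕ; zero; suc; _+_; _*_; _≥_)
open import Data.Nat.Properties
  using (+-assoc; +-suc; +-identityʳ; *-zeroʳ; *-distribˡ-+; *-distribʳ-+; suc-injective;
         +-commutativeSemigroup; *-commutativeSemigroup)
open import Algebra.Properties.CommutativeSemigroup +-commutativeSemigroup using (interchange)
open import Algebra.Properties.CommutativeSemigroup *-commutativeSemigroup using (x∙yz≈z∙yx)
open import Data.Nat.Combinatorics using (_C_; nCn≡1; nCk+nC[k+1]≡[n+1]C[k+1])
open import Data.Nat.ListAction using (sum)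
open import Data.Nat.ListAction.Properties using (sum-++)
open import Data.Fin using (zero; suc)
open import Data.Fin.Properties using (all?; _≟_)
open import Data.Vec using (Vec; []; _∷_; map)
open import Data.List using (List; []; _∷_; _++_; length; filter; concatMap)
import Data.List as List
open import Data.List.Properties using (map-++; map-cong; map-∘)
open import Data.List.Relation.Unary.All using ([]; _∷_)
open import Data.Product using (_×_; _,_)
open import Function using (_∘_; _⇔_; mk⇔; Equivalence)
open import Level using (Level)
open import Relation.Binary using (Setoid)
open import Relation.Binary.PropositionalEquality
open import Relation.Nullary using (Dec; yes; no; ¬_; contradiction)
open import Relation.Nullary.Decidable using (from-yes; _×-dec_)

pattern 1₃ = suc zero
pattern 2₃ = suc (suc zero)

Triple : Set
Triple = ℕ × ℕ × ℕ

𝟙 : ∀ {p} {P : Set p} → Dec P → ℕ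
𝟙 (yes _) = 1
𝟙 (no _)  = 0

𝟙-no : ∀ {p} {P : Set p} (P? : Dec P) → ¬ P → 𝟙 P? ≡ 0
𝟙-no (yes p) ¬p = contradiction p ¬p
𝟙-no (no _)  _  = refl

𝟙-cong : ∀ {p q} {P : Set p} {Q : Set q} (P? : Dec P) (Q? : Dec Q) → P ⇔ Q → 𝟙 P? ≡ 𝟙 Q?
𝟙-cong (yes _) (yes _) _   = refl
𝟙-cong (yes p) (no ¬q) P⇔Q = contradiction (Equivalence.to P⇔Q p) ¬q
𝟙-cong (no ¬p) (yes q) P⇔Q = contradiction (Equivalence.from P⇔Q q) ¬p
𝟙-cong (no _)  (no _)  _   = refl

𝟙-*-cong : ∀ {p} {P : Set p} (P? : Dec P) {m n : ℕ} → (P → m ≡ n) → 𝟙 P? * m ≡ 𝟙 P? * n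
𝟙-*-cong (yes p) m≡n = cong (1 *_) (m≡n p)
𝟙-*-cong (no _)  _   = refl

𝟙-×-dec : ∀ {p q} {P : Set p} {Q : Set q} (P? : Dec P) (Q? : Dec Q) → 𝟙 (P? ×-dec Q?) ≡ 𝟙 P? * 𝟙 Q?
𝟙-×-dec (yes _) (yes _) = refl
𝟙-×-dec (yes _) (no _)  = refl
𝟙-×-dec (no _)  _       = refl

private variable
  ℓ ℓ′ : Level
  A : Set ℓ
  B : Set ℓ′

length-filter≡sum-𝟙 : ∀ {p} {P : A → Set p} (P? : ∀ x → Dec (P x)) (xs : List A) →
  length (filter P? xs) ≡ sum (List.map (𝟙 ∘ P?) xs)
length-filter≡sum-𝟙 P? []       = refl
length-filter≡sum-𝟙 P? (x ∷ xs) with P? x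
... | yes _ = cong suc (length-filter≡sum-𝟙 P? xs)
... | no _  = length-filter≡sum-𝟙 P? xs

sum-map-cong : {f g : A → ℕ} (xs : List A) → (∀ x → f x ≡ g x) → sum (List.map f xs) ≡ sum (List.map g xs)
sum-map-cong xs f≗g = cong sum (map-cong f≗g xs)

sum-map-+ : (f g : A → ℕ) (xs : List A) →
  sum (List.map (λ x → f x + g x) xs) ≡ sum (List.map f xs) + sum (List.map g xs)
sum-map-+ f g []       = refl
sum-map-+ f g (x ∷ xs) = trans (cong (f x + g x +_) (sum-map-+ f g xs)) (interchange (f x) (g x) _ _)

sum-map-zero : (xs : List A) → sum (List.map (λ _ → 0) xs) ≡ 0
sum-map-zero []       = refl
sum-map-zero (_ ∷ xs) = sum-map-zero xs

sum-map-*ˡ : (k : ℕ) (f : A → ℕ) (xs : List A) → sum (List.map (λ x → k * f x) xs) ≡ k * sum (List.map f xs)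
sum-map-*ˡ k f []       = sym (*-zeroʳ k)
sum-map-*ˡ k f (x ∷ xs) = trans (cong (k * f x +_) (sum-map-*ˡ k f xs)) (sym (*-distribˡ-+ k (f x) _))

sum-map-*ʳ : (k : ℕ) (f : A → ℕ) (xs : List A) → sum (List.map (λ x → f x * k) xs) ≡ sum (List.map f xs) * k
sum-map-*ʳ k f []       = refl
sum-map-*ʳ k f (x ∷ xs) = trans (cong (f x * k +_) (sum-map-*ʳ k f xs)) (sym (*-distribʳ-+ k (f x) _))

sum-map-comm : (F : A → B → ℕ) (xs : List A) (ys : List B) →
  sum (List.map (λ x → sum (List.map (F x) ys)) xs) ≡ sum (List.map (λ y → sum (List.map (λ x → F x y) xs)) ys)
sum-map-comm F []       ys = sym (sum-map-zero ys)
sum-map-comm F (x ∷ xs) ys = trans (cong (sum (List.map (F x) ys) +_) (sum-map-comm F xs ys))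
                                   (sym (sum-map-+ (F x) _ ys))

sum-map-concatMap : (f : B → ℕ) (g : A → List B) (xs : List A) →
  sum (List.map f (concatMap g xs)) ≡ sum (List.map (λ x → sum (List.map f (g x))) xs)
sum-map-concatMap f g []       = refl
sum-map-concatMap f g (x ∷ xs) = begin
  sum (List.map f (g x ++ concatMap g xs))                    ≡⟨ cong sum (map-++ f (g x) _) ⟩
  sum (List.map f (g x) ++ List.map f (concatMap g xs))       ≡⟨ sum-++ (List.map f (g x)) _ ⟩
  sum (List.map f (g x)) + sum (List.map f (concatMap g xs))  ≡⟨ cong (_ +_) (sum-map-concatMap f g xs) ⟩
  sum (List.map (λ x → sum (List.map f (g x))) (x ∷ xs))      ∎
  where open ≡-Reasoning

incr : Z3 → Triple → Triple
incr zero (k₀ , k₁ , k₂) = suc k₀ , k₁ , k₂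
incr 1₃   (k₀ , k₁ , k₂) = k₀ , suc k₁ , k₂
incr 2₃   (k₀ , k₁ , k₂) = k₀ , k₁ , suc k₂

incr-comm : ∀ a b t → incr a (incr b t) ≡ incr b (incr a t)
incr-comm zero zero _ = refl
incr-comm zero 1₃   _ = refl
incr-comm zero 2₃   _ = refl
incr-comm 1₃   zero _ = refl
incr-comm 1₃   1₃   _ = refl
incr-comm 1₃   2₃   _ = refl
incr-comm 2₃   zero _ = refl
incr-comm 2₃   1₃   _ = refl
incr-comm 2₃   2₃   _ = refl

incr-injective : ∀ a {t t′} → incr a t ≡ incr a t′ → t ≡ t′
incr-injective zero {_ , _ , _} {_ , _ , _} refl = refl
incr-injective 1₃   {_ , _ , _} {_ , _ , _} refl = refl
incr-injective 2₃   {_ , _ , _} {_ , _ , _} refl = refl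

incr-≡⇔ : ∀ a {t t′} → incr a t ≡ incr a t′ ⇔ t ≡ t′
incr-≡⇔ a = mk⇔ (incr-injective a) (cong (incr a))

T-∷ : ∀ {n} a (w : Vec Z3 n) → T (a ∷ w) ≡ incr a (T w)
T-∷ zero _ = refl
T-∷ 1₃   _ = refl
T-∷ 2₃   _ = refl

module CommutingActions {c ℓ} (S : Setoid c ℓ)
  (f : Z3 → Setoid.Carrier S → Setoid.Carrier S)
  (f-cong : ∀ a {z z′} → Setoid._≈_ S z z′ → Setoid._≈_ S (f a z) (f a z′))
  (f-comm : ∀ a b z → Setoid._≈_ S (f a (f b z)) (f b (f a z)))
  where

  open Setoid S using (Carrier; _≈_) renaming (refl to ≈-refl; trans to ≈-trans)
  open import Relation.Binary.Reasoning.Setoid S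

  act : ∀ {n} → Vec Z3 n → Carrier → Carrier
  act []      z = z
  act (x ∷ u) z = act u (f x z)

  iter : Z3 → ℕ → Carrier → Carrier
  iter a zero    z = z
  iter a (suc k) z = iter a k (f a z)

  iter-cong : ∀ a k {z z′} → z ≈ z′ → iter a k z ≈ iter a k z′
  iter-cong a zero    z≈z′ = z≈z′
  iter-cong a (suc k) z≈z′ = iter-cong a k (f-cong a z≈z′)

  iter-comm : ∀ a k b z → iter a k (f b z) ≈ f b (iter a k z)
  iter-comm a zero    b z = ≈-refl
  iter-comm a (suc k) b z = ≈-trans (iter-cong a k (f-comm a b z)) (iter-comm a k b (f a z))

  normal : Triple → Carrier → Carrier
  normal (k₀ , k₁ , k₂) = iter zero k₀ ∘ iter 1₃ k₁ ∘ iter 2₃ k₂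

  normal-f : ∀ a t z → normal t (f a z) ≈ normal (incr a t) z
  normal-f zero (k₀ , k₁ , k₂) z = begin
    iter zero k₀ (iter 1₃ k₁ (iter 2₃ k₂ (f zero z)))  ≈⟨ iter-cong zero k₀ (iter-cong 1₃ k₁ (iter-comm 2₃ k₂ zero z)) ⟩
    iter zero k₀ (iter 1₃ k₁ (f zero (iter 2₃ k₂ z)))  ≈⟨ iter-cong zero k₀ (iter-comm 1₃ k₁ zero _) ⟩
    iter zero k₀ (f zero (iter 1₃ k₁ (iter 2₃ k₂ z)))  ∎
  normal-f 1₃ (k₀ , k₁ , k₂) z = iter-cong zero k₀ (iter-cong 1₃ k₁ (iter-comm 2₃ k₂ 1₃ z))
  normal-f 2₃ t z = ≈-refl

  act≈normal : ∀ {n} (u : Vec Z3 n) z → act u z ≈ normal (T u) z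
  act≈normal []      z = ≈-refl
  act≈normal (x ∷ u) z = begin
    act u (f x z)             ≈⟨ act≈normal u (f x z) ⟩
    normal (T u) (f x z)      ≈⟨ normal-f x (T u) z ⟩
    normal (incr x (T u)) z   ≡⟨ cong (λ t → normal t z) (T-∷ x u) ⟨
    normal (T (x ∷ u)) z      ∎

  act-T-invariant : ∀ {n} (u v : Vec Z3 n) → T u ≡ T v → ∀ z → act u z ≈ act v z
  act-T-invariant u v Tu≡Tv z = begin
    act u z          ≈⟨ act≈normal u z ⟩
    normal (T u) z   ≡⟨ cong (λ t → normal t z) Tu≡Tv ⟩
    normal (T v) z   ≈⟨ act≈normal v z ⟨
    act v z          ∎

+₃-comm-left : ∀ a b c → a +₃ (b +₃ c) ≡ b +₃ (a +₃ c)
+₃-comm-left = from-yes (all? λ a → all? λ b → all? λ c → a +₃ (b +₃ c) ≟ b +₃ (a +₃ c))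

*₃-comm : ∀ a b → a *₃ b ≡ b *₃ a
*₃-comm = from-yes (all? λ a → all? λ b → a *₃ b ≟ b *₃ a)

*₃-zeroʳ : ∀ a → a *₃ zero ≡ zero
*₃-zeroʳ = from-yes (all? λ a → a *₃ zero ≟ zero)

*₃-negʳ : ∀ a b → a *₃ neg₃ b ≡ neg₃ (a *₃ b)
*₃-negʳ = from-yes (all? λ a → all? λ b → a *₃ neg₃ b ≟ neg₃ (a *₃ b))

neg₃-+₃ : ∀ a b → neg₃ (a +₃ b) ≡ neg₃ a +₃ neg₃ b
neg₃-+₃ = from-yes (all? λ a → all? λ b → neg₃ (a +₃ b) ≟ neg₃ a +₃ neg₃ b)

·-comm : ∀ {n} (w u : Vec Z3 n) → w · u ≡ u · w
·-comm []      []      = refl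
·-comm (a ∷ w) (x ∷ u) = cong₂ _+₃_ (*₃-comm a x) (·-comm w u)

·-zeroʳ : ∀ {n} (w : Vec Z3 n) → w · zeroVec n ≡ zero
·-zeroʳ []      = refl
·-zeroʳ (a ∷ w) = cong₂ _+₃_ (*₃-zeroʳ a) (·-zeroʳ w)

·-negʳ : ∀ {n} (w u : Vec Z3 n) → w · map neg₃ u ≡ neg₃ (w · u)
·-negʳ []      []      = refl
·-negʳ (a ∷ w) (x ∷ u) = begin
  (a *₃ neg₃ x) +₃ (w · map neg₃ u)  ≡⟨ cong₂ _+₃_ (*₃-negʳ a x) (·-negʳ w u) ⟩
  neg₃ (a *₃ x) +₃ neg₃ (w · u)       ≡⟨ neg₃-+₃ (a *₃ x) (w · u) ⟨
  neg₃ ((a *₃ x) +₃ (w · u))          ∎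
  where open ≡-Reasoning

inDual-Cv⇔ : ∀ {n} (u w : Vec Z3 n) → inDual (Cv u) w ⇔ w · u ≡ zero
inDual-Cv⇔ u w with isZeroVec? u
... | yes refl = mk⇔ (λ { (w·0≡0 ∷ []) → w·0≡0 }) (λ w·0≡0 → w·0≡0 ∷ [])
... | no _     = mk⇔ (λ { (_ ∷ w·u≡0 ∷ _) → w·u≡0 })
                     (λ w·u≡0 → ·-zeroʳ w ∷ w·u≡0 ∷ trans (·-negʳ w u) (cong neg₃ w·u≡0) ∷ [])

elements₃ : List Z3
elements₃ = zero ∷ 1₃ ∷ 2₃ ∷ []

Σ₃ : (Z3 → ℕ) → ℕ
Σ₃ f = sum (List.map f elements₃)

∑ : ∀ {n} → (Vec Z3 n → ℕ) → ℕ
∑ {n} f = sum (List.map f (allVecs n))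

∑-∷ : ∀ {n} (f : Vec Z3 (suc n) → ℕ) → ∑ f ≡ Σ₃ (λ a → ∑ (λ w → f (a ∷ w)))
∑-∷ {n} f = trans (sum-map-concatMap f (λ a → List.map (a ∷_) (allVecs n)) elements₃)
                  (sum-map-cong elements₃ λ a → cong sum (sym (map-∘ {g = f} {f = a ∷_} (allVecs n))))

Weight : Set
Weight = Z3 × Triple → ℕ

profile : ∀ {n} → Vec Z3 n → Weight → ℕ
profile u φ = ∑ λ w → φ (w · u , T w)

shift : Z3 → Weight → Weight
shift x φ (c , t) = Σ₃ λ a → φ ((a *₃ x) +₃ c , incr a t)

shift-cong : ∀ x {φ ψ : Weight} → φ ≗ ψ → shift x φ ≗ shift x ψ
shift-cong x φ≗ψ (c , t) = sum-map-cong elements₃ λ a → φ≗ψ ((a *₃ x) +₃ c , incr a t)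

shift-comm : ∀ x y (φ : Weight) → shift x (shift y φ) ≗ shift y (shift x φ)
shift-comm x y φ (c , t) = trans (sum-map-comm (λ a b → φ ((b *₃ y) +₃ ((a *₃ x) +₃ c) , incr b (incr a t)))
                                                 elements₃ elements₃)
  (sum-map-cong elements₃ λ a → sum-map-cong elements₃ λ b →
    cong₂ (λ c′ t′ → φ (c′ , t′)) (+₃-comm-left (a *₃ y) (b *₃ x) c) (incr-comm a b t))

profile-∷ : ∀ {n} x (u : Vec Z3 n) φ → profile (x ∷ u) φ ≡ profile u (shift x φ)
profile-∷ {n} x u φ = begin
  profile (x ∷ u) φ                                                 ≡⟨ ∑-∷ (λ w → φ (w · (x ∷ u) , T w)) ⟩
  Σ₃ (λ a → ∑ λ w → φ ((a *₃ x) +₃ (w · u) , T (a ∷ w)))           ≡⟨ sum-map-cong elements₃ (λ a →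
                                                                         sum-map-cong (allVecs n) λ w →
                                                                           cong (λ t → φ ((a *₃ x) +₃ (w · u) , t)) (T-∷ a w)) ⟩
  Σ₃ (λ a → ∑ λ w → φ ((a *₃ x) +₃ (w · u) , incr a (T w)))        ≡⟨ sum-map-comm (λ a w → φ ((a *₃ x) +₃ (w · u) , incr a (T w)))
                                                                                     elements₃ (allVecs n) ⟩
  profile u (shift x φ)                                             ∎
  where open ≡-Reasoning

module ShiftActions = CommutingActions ((Z3 × Triple) →-setoid ℕ) shift shift-cong shift-comm

profile-act : ∀ {n} (u : Vec Z3 n) φ → profile u φ ≡ ShiftActions.act u φ (zero , 0 , 0 , 0)
profile-act []      φ = +-identityʳ _
profile-act (x ∷ u) φ = trans (profile-∷ x u φ) (profile-act u (shift x φ))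

profile-T-invariant : ∀ {n} (u v : Vec Z3 n) → T u ≡ T v → ∀ φ → profile u φ ≡ profile v φ
profile-T-invariant u v Tu≡Tv φ = begin
  profile u φ                                ≡⟨ profile-act u φ ⟩
  ShiftActions.act u φ (zero , 0 , 0 , 0)    ≡⟨ ShiftActions.act-T-invariant u v Tu≡Tv φ _ ⟩
  ShiftActions.act v φ (zero , 0 , 0 , 0)    ≡⟨ profile-act v φ ⟨
  profile v φ                                ∎
  where open ≡-Reasoning

χ : Triple → Weight
χ t (c , τ) = 𝟙 (c ≟ zero) * 𝟙 (τ ≟T t)

A-dual≡profile : ∀ {n} (u : Vec Z3 n) t → A-dual u t ≡ profile u (χ t)
A-dual≡profile {n} u t = begin
  A-dual u t                                                 ≡⟨ length-filter≡sum-𝟙 _ (allVecs n) ⟩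
  ∑ (λ w → 𝟙 (inDual? (Cv u) w ×-dec (T w ≟T t)))            ≡⟨ sum-map-cong (allVecs n) (λ w →
                                                                  𝟙-×-dec (inDual? (Cv u) w) (T w ≟T t)) ⟩
  ∑ (λ w → 𝟙 (inDual? (Cv u) w) * 𝟙 (T w ≟T t))              ≡⟨ sum-map-cong (allVecs n) (λ w →
                                                                  cong (_* 𝟙 (T w ≟T t))
                                                                    (𝟙-cong (inDual? (Cv u) w) ((w · u) ≟ zero) (inDual-Cv⇔ u w))) ⟩
  profile u (χ t)                                            ∎
  where open ≡-Reasoning

countType : ∀ n → Triple → ℕ
countType n s = ∑ {n} λ w → 𝟙 (T w ≟T s)

orthogonalPairs : ∀ n → Triple → Triple → ℕ
orthogonalPairs n s t = ∑ {n} λ u → ∑ λ w → 𝟙 (T u ≟T s) * χ t (w · u , T w)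

orthogonalPairs-sym : ∀ n s t → orthogonalPairs n s t ≡ orthogonalPairs n t s
orthogonalPairs-sym n s t =
  trans (sum-map-comm (λ u w → 𝟙 (T u ≟T s) * χ t (w · u , T w)) (allVecs n) (allVecs n))
        (sum-map-cong (allVecs n) λ w → sum-map-cong (allVecs n) λ u →
          trans (cong (λ d → 𝟙 (T u ≟T s) * (𝟙 (d ≟ zero) * 𝟙 (T w ≟T t))) (·-comm w u))
                (x∙yz≈z∙yx (𝟙 (T u ≟T s)) (𝟙 ((u · w) ≟ zero)) (𝟙 (T w ≟T t))))

orthogonalPairs≡countType*profile : ∀ {n} (u₀ : Vec Z3 n) {s} → T u₀ ≡ s → ∀ t →
  orthogonalPairs n s t ≡ countType n s * profile u₀ (χ t)
orthogonalPairs≡countType*profile {n} u₀ {s} Tu₀≡s t = begin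
  orthogonalPairs n s t                            ≡⟨ sum-map-cong (allVecs n) (λ u → sum-map-*ˡ (𝟙 (T u ≟T s)) _ (allVecs n)) ⟩
  ∑ {n} (λ u → 𝟙 (T u ≟T s) * profile u (χ t))    ≡⟨ sum-map-cong (allVecs n) (λ u → 𝟙-*-cong (T u ≟T s)
                                                        λ Tu≡s → profile-T-invariant u u₀ (trans Tu≡s (sym Tu₀≡s)) (χ t)) ⟩
  ∑ {n} (λ u → 𝟙 (T u ≟T s) * profile u₀ (χ t))   ≡⟨ sum-map-*ʳ (profile u₀ (χ t)) _ (allVecs n) ⟩
  countType n s * profile u₀ (χ t)                 ∎
  where open ≡-Reasoning

atPred : Z3 → Triple → (Triple → ℕ) → ℕ
atPred zero (zero   , k₁ , k₂) g = 0
atPred zero (suc k₀ , k₁ , k₂) g = g (k₀ , k₁ , k₂)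
atPred 1₃   (k₀ , zero   , k₂) g = 0
atPred 1₃   (k₀ , suc k₁ , k₂) g = g (k₀ , k₁ , k₂)
atPred 2₃   (k₀ , k₁ , zero  ) g = 0
atPred 2₃   (k₀ , k₁ , suc k₂) g = g (k₀ , k₁ , k₂)

𝟙-incr≡ : ∀ a t s → 𝟙 (incr a t ≟T s) ≡ atPred a s (λ s′ → 𝟙 (t ≟T s′))
𝟙-incr≡ zero t@(_ , _ , _) s@(zero  , _ , _) = 𝟙-no (incr zero t ≟T s) λ ()
𝟙-incr≡ zero t@(_ , _ , _) s@(suc _ , _ , _) = 𝟙-cong (incr zero t ≟T s) (t ≟T _) (incr-≡⇔ zero)
𝟙-incr≡ 1₃   t@(_ , _ , _) s@(_ , zero  , _) = 𝟙-no (incr 1₃ t ≟T s) λ ()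
𝟙-incr≡ 1₃   t@(_ , _ , _) s@(_ , suc _ , _) = 𝟙-cong (incr 1₃ t ≟T s) (t ≟T _) (incr-≡⇔ 1₃)
𝟙-incr≡ 2₃   t@(_ , _ , _) s@(_ , _ , zero ) = 𝟙-no (incr 2₃ t ≟T s) λ ()
𝟙-incr≡ 2₃   t@(_ , _ , _) s@(_ , _ , suc _) = 𝟙-cong (incr 2₃ t ≟T s) (t ≟T _) (incr-≡⇔ 2₃)

sum-map-atPred : ∀ a s (g : Triple → A → ℕ) (xs : List A) →
  sum (List.map (λ x → atPred a s (λ s′ → g s′ x)) xs) ≡ atPred a s (λ s′ → sum (List.map (g s′) xs))
sum-map-atPred zero (zero  , _ , _) g xs = sum-map-zero xs
sum-map-atPred zero (suc _ , _ , _) g xs = refl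
sum-map-atPred 1₃   (_ , zero  , _) g xs = sum-map-zero xs
sum-map-atPred 1₃   (_ , suc _ , _) g xs = refl
sum-map-atPred 2₃   (_ , _ , zero ) g xs = sum-map-zero xs
sum-map-atPred 2₃   (_ , _ , suc _) g xs = refl

countType-suc : ∀ n s → countType (suc n) s ≡ Σ₃ λ a → atPred a s (countType n)
countType-suc n s = begin
  countType (suc n) s                                      ≡⟨ ∑-∷ {n} (λ w → 𝟙 (T w ≟T s)) ⟩
  Σ₃ (λ a → ∑ {n} λ w → 𝟙 (T (a ∷ w) ≟T s))                ≡⟨ sum-map-cong elements₃ (λ a →
                                                                sum-map-cong (allVecs n) λ w →
                                                                  cong (λ τ → 𝟙 (τ ≟T s)) (T-∷ a w)) ⟩
  Σ₃ (λ a → ∑ {n} λ w → 𝟙 (incr a (T w) ≟T s))             ≡⟨ sum-map-cong elements₃ (λ a →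
                                                                sum-map-cong (allVecs n) λ w → 𝟙-incr≡ a (T w) s) ⟩
  Σ₃ (λ a → ∑ {n} λ w → atPred a s λ s′ → 𝟙 (T w ≟T s′))   ≡⟨ sum-map-cong elements₃ (λ a →
                                                                sum-map-atPred a s (λ s′ w → 𝟙 (T w ≟T s′)) (allVecs n)) ⟩
  Σ₃ (λ a → atPred a s (countType n))                      ∎
  where open ≡-Reasoning

atPred-cong : ∀ a s {m} {g h : Triple → ℕ} → tsum s ≡ suc m → (∀ s′ → tsum s′ ≡ m → g s′ ≡ h s′) →
  atPred a s g ≡ atPred a s h
atPred-cong zero (zero   , _  , _ ) _ _ = refl
atPred-cong zero (suc k₀ , k₁ , k₂) Σs g≗h = g≗h _ (suc-injective Σs)
atPred-cong 1₃   (_  , zero   , _ ) _ _ = refl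
atPred-cong 1₃   (k₀ , suc k₁ , k₂) Σs g≗h = g≗h _ (suc-injective (trans (cong (_+ k₂) (sym (+-suc k₀ k₁))) Σs))
atPred-cong 2₃   (_  , _  , zero  ) _ _ = refl
atPred-cong 2₃   (k₀ , k₁ , suc k₂) Σs g≗h = g≗h _ (suc-injective (trans (sym (+-suc (k₀ + k₁) k₂)) Σs))

multinomial-assoc : ∀ k₀ k₁ k₂ → multinomial (k₀ , k₁ , k₂) ≡ ((k₀ + (k₁ + k₂)) C k₀) * ((k₁ + k₂) C k₁)
multinomial-assoc k₀ k₁ k₂ = cong (λ m → (m C k₀) * ((k₁ + k₂) C k₁)) (+-assoc k₀ k₁ k₂)

[n+0]Cn≡1 : ∀ n → (n + 0) C n ≡ 1
[n+0]Cn≡1 n = trans (cong (_C n) (+-identityʳ n)) (nCn≡1 n)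

multinomial-pascal₁₂ : ∀ k₀ k₁ k₂ {k} → k₁ + k₂ ≡ suc k →
  atPred 1₃ (k₀ , k₁ , k₂) multinomial + atPred 2₃ (k₀ , k₁ , k₂) multinomial
    ≡ ((k₀ + k) C k₀) * ((k₁ + k₂) C k₁)
multinomial-pascal₁₂ k₀ zero     (suc k₂) refl = cong (λ m → (m C k₀) * 1) (cong (_+ k₂) (+-identityʳ k₀))
multinomial-pascal₁₂ k₀ (suc k₁) zero     refl = begin
  multinomial (k₀ , k₁ , 0) + 0                ≡⟨ +-identityʳ _ ⟩
  multinomial (k₀ , k₁ , 0)                    ≡⟨ multinomial-assoc k₀ k₁ 0 ⟩
  ((k₀ + (k₁ + 0)) C k₀) * ((k₁ + 0) C k₁)     ≡⟨ cong (((k₀ + (k₁ + 0)) C k₀) *_)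
                                                      (trans ([n+0]Cn≡1 k₁) (sym ([n+0]Cn≡1 (suc k₁)))) ⟩
  ((k₀ + (k₁ + 0)) C k₀) * ((suc k₁ + 0) C suc k₁) ∎
  where open ≡-Reasoning
multinomial-pascal₁₂ k₀ (suc k₁) (suc k₂) refl = begin
  multinomial (k₀ , k₁ , suc k₂) + multinomial (k₀ , suc k₁ , k₂)
    ≡⟨ cong₂ _+_ (multinomial-assoc k₀ k₁ (suc k₂)) (multinomial-assoc k₀ (suc k₁) k₂) ⟩
  ((k₀ + k) C k₀) * (k C k₁) + ((k₀ + suc (k₁ + k₂)) C k₀) * (suc (k₁ + k₂) C suc k₁)
    ≡⟨ cong (λ m → ((k₀ + k) C k₀) * (k C k₁) + ((k₀ + m) C k₀) * (m C suc k₁)) (+-suc k₁ k₂) ⟨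
  ((k₀ + k) C k₀) * (k C k₁) + ((k₀ + k) C k₀) * (k C suc k₁)
    ≡⟨ *-distribˡ-+ ((k₀ + k) C k₀) (k C k₁) (k C suc k₁) ⟨
  ((k₀ + k) C k₀) * (k C k₁ + k C suc k₁)
    ≡⟨ cong (((k₀ + k) C k₀) *_) (nCk+nC[k+1]≡[n+1]C[k+1] k k₁) ⟩
  ((k₀ + k) C k₀) * (suc k C suc k₁) ∎
  where
  open ≡-Reasoning
  k = k₁ + suc k₂

multinomial-pascal-pos : ∀ k₀ k₁ k₂ {k} → k₁ + k₂ ≡ suc k →
  Σ₃ (λ a → atPred a (k₀ , k₁ , k₂) multinomial) ≡ multinomial (k₀ , k₁ , k₂)
multinomial-pascal-pos k₀ k₁ k₂ {k} k₁+k₂≡1+k = begin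
  Σ₃ (λ a → atPred a (k₀ , k₁ , k₂) multinomial)
    ≡⟨ cong (atPred zero (k₀ , k₁ , k₂) multinomial +_) (cong (atPred 1₃ (k₀ , k₁ , k₂) multinomial +_) (+-identityʳ _)) ⟩
  atPred zero (k₀ , k₁ , k₂) multinomial + (atPred 1₃ (k₀ , k₁ , k₂) multinomial + atPred 2₃ (k₀ , k₁ , k₂) multinomial)
    ≡⟨ cong (atPred zero (k₀ , k₁ , k₂) multinomial +_) (multinomial-pascal₁₂ k₀ k₁ k₂ k₁+k₂≡1+k) ⟩
  atPred zero (k₀ , k₁ , k₂) multinomial + ((k₀ + k) C k₀) * c₁₂
    ≡⟨ first-row k₀ ⟩
  multinomial (k₀ , k₁ , k₂) ∎
  where
  open ≡-Reasoning
  c₁₂ = (k₁ + k₂) C k₁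
  first-row : ∀ k₀ → atPred zero (k₀ , k₁ , k₂) multinomial + ((k₀ + k) C k₀) * c₁₂ ≡ multinomial (k₀ , k₁ , k₂)
  first-row zero     = refl
  first-row (suc k₀) = begin
    multinomial (k₀ , k₁ , k₂) + (suc (k₀ + k) C suc k₀) * c₁₂
      ≡⟨ cong (_+ (suc (k₀ + k) C suc k₀) * c₁₂) (multinomial-assoc k₀ k₁ k₂) ⟩
    ((k₀ + (k₁ + k₂)) C k₀) * c₁₂ + (suc (k₀ + k) C suc k₀) * c₁₂
      ≡⟨ cong₂ (λ m m′ → (m C k₀) * c₁₂ + (m′ C suc k₀) * c₁₂) (cong (k₀ +_) k₁+k₂≡1+k) (sym (+-suc k₀ k)) ⟩
    ((k₀ + suc k) C k₀) * c₁₂ + ((k₀ + suc k) C suc k₀) * c₁₂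
      ≡⟨ *-distribʳ-+ c₁₂ ((k₀ + suc k) C k₀) ((k₀ + suc k) C suc k₀) ⟨
    ((k₀ + suc k) C k₀ + (k₀ + suc k) C suc k₀) * c₁₂
      ≡⟨ cong (_* c₁₂) (nCk+nC[k+1]≡[n+1]C[k+1] (k₀ + suc k) k₀) ⟩
    (suc (k₀ + suc k) C suc k₀) * c₁₂
      ≡⟨ cong (λ m → (suc (k₀ + m) C suc k₀) * c₁₂) k₁+k₂≡1+k ⟨
    ((suc k₀ + (k₁ + k₂)) C suc k₀) * c₁₂
      ≡⟨ multinomial-assoc (suc k₀) k₁ k₂ ⟨
    multinomial (suc k₀ , k₁ , k₂) ∎

multinomial-pascal : ∀ s {m} → tsum s ≡ suc m → Σ₃ (λ a → atPred a s multinomial) ≡ multinomial s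
multinomial-pascal (suc k₀ , zero , zero) _ = begin
  multinomial (k₀ , 0 , 0) + 0                 ≡⟨ +-identityʳ _ ⟩
  multinomial (k₀ , 0 , 0)                     ≡⟨ multinomial-assoc k₀ 0 0 ⟩
  ((k₀ + 0) C k₀) * 1                          ≡⟨ cong (_* 1) (trans ([n+0]Cn≡1 k₀) (sym ([n+0]Cn≡1 (suc k₀)))) ⟩
  ((suc k₀ + 0) C suc k₀) * 1                  ≡⟨ multinomial-assoc (suc k₀) 0 0 ⟨
  multinomial (suc k₀ , 0 , 0)                 ∎
  where open ≡-Reasoning
multinomial-pascal (k₀ , zero , suc k₂) _ = multinomial-pascal-pos k₀ 0 (suc k₂) refl
multinomial-pascal (k₀ , suc k₁ , k₂) _ = multinomial-pascal-pos k₀ (suc k₁) k₂ refl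

countType≡multinomial : ∀ n s → tsum s ≡ n → countType n s ≡ multinomial s
countType≡multinomial zero    (zero , zero , zero) _ = refl
countType≡multinomial (suc m) s Σs≡1+m = begin
  countType (suc m) s                            ≡⟨ countType-suc m s ⟩
  Σ₃ (λ a → atPred a s (countType m))            ≡⟨ sum-map-cong elements₃ (λ a →
                                                      atPred-cong a s Σs≡1+m λ s′ → countType≡multinomial m s′) ⟩
  Σ₃ (λ a → atPred a s multinomial)              ≡⟨ multinomial-pascal s Σs≡1+m ⟩
  multinomial s                                  ∎
  where open ≡-Reasoning

lemma2p1 : (n : ℕ) → n ≥ 1 → (s t : ℕ × ℕ × ℕ) → tsum s ≡ n → tsum t ≡ n →
    (u v : Vec Z3 n) → T u ≡ s → T v ≡ t →
    multinomial s * A-dual u t ≡ multinomial t * A-dual v s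
lemma2p1 n _ s t Σs≡n Σt≡n u v Tu≡s Tv≡t = begin
  multinomial s * A-dual u t       ≡⟨ cong₂ _*_ (sym (countType≡multinomial n s Σs≡n)) (A-dual≡profile u t) ⟩
  countType n s * profile u (χ t)  ≡⟨ orthogonalPairs≡countType*profile u Tu≡s t ⟨
  orthogonalPairs n s t            ≡⟨ orthogonalPairs-sym n s t ⟩
  orthogonalPairs n t s            ≡⟨ orthogonalPairs≡countType*profile v Tv≡t s ⟩
  countType n t * profile v (χ s)  ≡⟨ cong₂ _*_ (countType≡multinomial n t Σt≡n) (sym (A-dual≡profile v s)) ⟩
  multinomial t * A-dual v s       ∎
  where open ≡-Reasoning
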